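{- A rule set $\mathcal{R}$ never-terminates if there is a cyclicity sequence for some KB with $\mathcal{R}$ and some head-choice.
   Context: Setting (restricted disjunctive chase). A (disjunctive existential) rule $\rho$ is a constant- and function-free formula $\forall \vec w,\vec x.[\beta(\vec w,\vec x)\to \bigvee_{i=1}^n \exists \vec y_i.\eta_i(\vec x_i,\vec y_i)]$ with $n\ge 1$, $\bigcup_i \vec x_i=\vec x$, and $\beta,\eta_i$ non-empty conjunctions of atoms; $\mathrm{frontier}(\rho)=\vec x$, $\mathrm{body}(\rho)=\beta$, $\mathrm{head}_i(\rho)=\eta_i$, $\mathrm{branching}(\rho)=n$. The rule is deterministic if $n=1$, generating if some $\vec y_i$ is non-empty, datalog if deterministic and non-generating. A substitution is a partial map from variables to ground terms. The skolemization $\mathrm{sk}(\rho)$ replaces each $y\in\vec y_i$ by $f^\rho_{i,y}(\vec x)$, where $f^\rho_{i,y}$ is a fresh function symbol unique for $(\rho,i,y)$. A trigger $\lambda=(\rho,\sigma)$ consists of a rule and a substitution with domain the body variables; it is loaded for a fact set $F$ if $\mathrm{body}(\rho)\sigma\subseteq F$, and obsolete for $F$ if some extension $\sigma'$ of $\sigma$ satisfies $\mathrm{head}_i(\rho)\sigma'\subseteq F$ for some $i$. $\mathrm{out}_i(\lambda)=\mathrm{head}_i(\mathrm{sk}(\rho))\sigma$. An $\mathcal{R}$-term is a term built from function symbols of $\mathrm{sk}(\mathcal{R})$, constants and variables; an $\mathcal{R}$-trigger is a trigger with a rule from $\mathcal{R}$ and a substitution whose range consists of $\mathcal{R}$-terms.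 A database is a function-free fact set and a KB is a pair $(\mathcal{R},D)$. A chase tree of $(\mathcal{R},D)$ is a directed tree whose vertices carry fact-labels (root labelled $D$) and whose non-root vertices carry trigger-labels, such that: every non-leaf vertex $v$ has, for some $\mathcal{R}$-trigger $\lambda=(\rho,\sigma)$ loaded and not obsolete for its fact-label (where, if $\rho$ is not datalog, the label of $v$ must satisfy all datalog rules of $\mathcal{R}$), exactly $\mathrm{branching}(\rho)$ children $c_i$ with fact-label (label of $v$)$\cup\mathrm{out}_i(\lambda)$ and trigger-label $\lambda$; every leaf label satisfies all rules of $\mathcal{R}$; and fairness holds (every $\mathcal{R}$-trigger loaded at some vertex $v$ is obsolete for all vertices reachable from $v$ by paths of some length $k$). $\mathcal{R}$ never-terminates if some KB with $\mathcal{R}$ has no finite chase tree. A head-choice $hc$ for $\mathcal{R}$ maps each $\rho\in\mathcal{R}$ to an element of $\{1,\dots,\mathrm{branching}(\rho)\}$; $\mathrm{out}_{hc}(\lambda)=\mathrm{out}_{hc(\rho)}(\lambda)$. For a chase tree $T$, $\mathrm{branch}(T,hc)=v_1,v_2,\dots$ is the branch from the root with label$(v_{i+1})$ = label$(v_i)\cup\mathrm{out}_{hc}(\text{trigger}(v_{i+1}))$. For a KB $K=(\mathcal{R},D)$, head-choice $hc$, and sequence $\Lambda=\lambda_1,\lambda_2,\dots$ of $\mathcal{R}$-triggers: $F_0=D$, $F_{i+1}=F_i\cup\mathrm{out}_{hc}(\lambda_{i+1})$; $\Lambda$ is loaded if each $\lambda_{i+1}$ is loaded for $F_i$; $\Lambda$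 is growing if for every $i$ there is $j>i$ and a term occurring in $F_j$ but not in $F_i$. An $\mathcal{R}$-trigger $\lambda$ is g-unblockable for $K$ and $hc$ if for every chase tree $T$ of $K$ and every vertex $v$ on $\mathrm{branch}(T,hc)$ for whose label $\lambda$ is loaded, some vertex $u$ on $\mathrm{branch}(T,hc)$ has $\mathrm{out}_{hc}(\lambda)\subseteq$ label$(u)$; $\Lambda$ is g-unblockable if all its triggers are. A cyclicity sequence of $K$ and $hc$ is an (infinite) sequence of $\mathcal{R}$-triggers that is loaded, growing and g-unblockable. -}

module Defs where

open import Data.Nat using (ℕ; zero; suc; _<_; _≟_)
open import Data.List using (List; []; _∷_; map; concatMap; filter; length; deduplicate; _++_)
open import Data.List.Membership.Propositional using (_∈_)
open import Data.List.Membership.DecPropositional _≟_ using (_∈?_)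
open import Data.List.Relation.Unary.All using (All)
open import Data.Product using (Σ; _×_; _,_)
open import Data.Sum using (_⊎_)
open import Data.Bool using (if_then_else_)
open import Relation.Nullary using (¬_; does)
open import Relation.Binary.PropositionalEquality using (_≡_)

-- Syntax of rules (constant- and function-free).
-- Variables, predicate symbols and constants are natural numbers.

record RAtom : Set where
  constructor ratom
  field
    pred : ℕ
    vars : List ℕ

-- A rule  β → ⋁_i ∃ y_i. η_i : body β, heads [η_1, …, η_n].
-- The existential variables y_i of head i are the variables of η_i not in β;
-- the frontier is the set of body variables occurring in some head.
record Rule : Set where
  constructor rule
  field
    body  : List RAtom
    heads : List (List RAtom)

open Rule public

atomsVars : List RAtom → List ℕ
atomsVars = concatMap RAtom.vars

bodyVars : Rule → List ℕ
bodyVars ρ = atomsVars (body ρ)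

-- head number i (0-based); empty list if out of range
headAt : List (List RAtom) → ℕ → List RAtom
headAt []       _       = []
headAt (h ∷ _)  zero    = h
headAt (_ ∷ hs) (suc i) = headAt hs i

branching : Rule → ℕ
branching ρ = length (heads ρ)

allHeadVars : Rule → List ℕ
allHeadVars ρ = concatMap atomsVars (heads ρ)

frontier : Rule → List ℕ
frontier ρ = deduplicate _≟_ (filter (_∈? allHeadVars ρ) (bodyVars ρ))

IsExistential : Rule → ℕ → ℕ → Set
IsExistential ρ i y = (y ∈ atomsVars (headAt (heads ρ) i)) × ¬ (y ∈ bodyVars ρ)

WellFormed : Rule → Set
WellFormed ρ = ¬ (body ρ ≡ []) × ¬ (heads ρ ≡ []) × All (λ h → ¬ (h ≡ [])) (heads ρ)

Deterministic : Rule → Set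
Deterministic ρ = branching ρ ≡ 1

Generating : Rule → Set
Generating ρ = Σ ℕ λ i → i < branching ρ × Σ ℕ λ y → IsExistential ρ i y

Datalog : Rule → Set
Datalog ρ = Deterministic ρ × ¬ Generating ρ

-- Ground terms: constants and skolem terms f^ρ_{i,y}(t⃗) (head index i is 0-based)

data Term : Set where
  cst : ℕ → Term
  fn  : Rule → ℕ → ℕ → List Term → Term

record Fact : Set where
  constructor fact
  field
    pred : ℕ
    args : List Term

FactSet : Set₁
FactSet = Fact → Set

_∪L_ : FactSet → List Fact → FactSet
(F ∪L L) f = F f ⊎ (f ∈ L)

data RTerm (R : List Rule) : Term → Set where
  cst : ∀ c → RTerm R (cst c)
  fn  : ∀ {ρ i y ts} → ρ ∈ R → i < branching ρ → IsExistential ρ i y →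
        length ts ≡ length (frontier ρ) → All (RTerm R) ts → RTerm R (fn ρ i y ts)

-- substitutions (only their values on the body variables matter)
Subst : Set
Subst = ℕ → Term

inst : Subst → RAtom → Fact
inst σ (ratom P xs) = fact P (map σ xs)

record Trigger : Set where
  constructor trig
  field
    rul : Rule
    sub : Subst

open Trigger public

RTrigger : List Rule → Trigger → Set
RTrigger R (trig ρ σ) = (ρ ∈ R) × (∀ x → x ∈ bodyVars ρ → RTerm R (σ x))

Loaded : Trigger → FactSet → Set
Loaded (trig ρ σ) F = All (λ a → F (inst σ a)) (body ρ)

Obsolete : Trigger → FactSet → Set
Obsolete (trig ρ σ) F =
  Σ Subst λ σ' → (∀ x → x ∈ bodyVars ρ → σ' x ≡ σ x) ×
  Σ ℕ λ i → i < branching ρ × All (λ a → F (inst σ' a)) (headAt (heads ρ) i)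

-- the value of a head variable in head_i(sk ρ) σ
skVal : Rule → ℕ → Subst → ℕ → Term
skVal ρ i σ v = if does (v ∈? bodyVars ρ) then σ v else fn ρ i v (map σ (frontier ρ))

out : Trigger → ℕ → List Fact
out (trig ρ σ) i = map (inst (skVal ρ i σ)) (headAt (heads ρ) i)

Satisfies : FactSet → Rule → Set
Satisfies F ρ = ∀ σ → Loaded (trig ρ σ) F → Obsolete (trig ρ σ) F

SatisfiesAll : List Rule → FactSet → Set
SatisfiesAll R F = ∀ ρ → ρ ∈ R → Satisfies F ρ

SatisfiesDatalog : List Rule → FactSet → Set
SatisfiesDatalog R F = ∀ ρ → ρ ∈ R → Datalog ρ → Satisfies F ρ

Database : List Fact → Set
Database D = All (λ f → All (λ t → Σ ℕ λ c → t ≡ cst c) (Fact.args f)) D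

asSet : List Fact → FactSet
asSet D f = f ∈ D

-- Vertices are addresses: lists of child indices, most recent
-- step first (so the children of p are i ∷ p and descendants are q ++ p).
-- exp p is the trigger used to expand vertex p (= trigger-label of its children).

Addr : Set
Addr = List ℕ

label : FactSet → (Addr → Trigger) → Addr → FactSet
label D e []      = D
label D e (i ∷ p) = label D e p ∪L out (e p) i

record ChaseTree (R : List Rule) (D : List Fact) : Set₁ where
  field
    isV     : Addr → Set
    exp     : Addr → Trigger
    rootV   : isV []
    parentV : ∀ i p → isV (i ∷ p) → isV p
    expand  : ∀ p → isV p →
      ( (∀ i → ¬ isV (i ∷ p)) × SatisfiesAll R (label (asSet D) exp p) )
      ⊎
      ( RTrigger R (exp p)
      × Loaded (exp p) (label (asSet D) exp p)
      × ¬ Obsolete (exp p) (label (asSet D) exp p)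
      × (¬ Datalog (rul (exp p)) → SatisfiesDatalog R (label (asSet D) exp p))
      × (∀ i → (isV (i ∷ p) → i < branching (rul (exp p)))
                × (i < branching (rul (exp p)) → isV (i ∷ p))) )
    fair : ∀ p → isV p → ∀ λ' → RTrigger R λ' → Loaded λ' (label (asSet D) exp p) →
      Σ ℕ λ k → ∀ q → length q ≡ k → isV (q ++ p) →
        Obsolete λ' (label (asSet D) exp (q ++ p))

open ChaseTree public

lab : ∀ {R D} → ChaseTree R D → Addr → FactSet
lab {D = D} T = label (asSet D) (exp T)

FiniteTree : ∀ {R D} → ChaseTree R D → Set
FiniteTree T = Σ (List Addr) λ L → ∀ p → isV T p → p ∈ L

NeverTerminates : List Rule → Set₁
NeverTerminates R = Σ (List Fact) λ D → Database D × ¬ (Σ (ChaseTree R D) FiniteTree)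

HeadChoice : List Rule → (Rule → ℕ) → Set
HeadChoice R hc = ∀ ρ → ρ ∈ R → hc ρ < branching ρ

outHC : (Rule → ℕ) → Trigger → List Fact
outHC hc λ' = out λ' (hc (rul λ'))

-- the n-th address of branch(T, hc) (a vertex iff it is on the branch)
branchAddr : ∀ {R D} → ChaseTree R D → (Rule → ℕ) → ℕ → Addr
branchAddr T hc zero    = []
branchAddr T hc (suc n) = hc (rul (exp T (branchAddr T hc n))) ∷ branchAddr T hc n

GUnblockable : List Rule → List Fact → (Rule → ℕ) → Trigger → Set₁
GUnblockable R D hc λ' =
  (T : ChaseTree R D) → ∀ n → isV T (branchAddr T hc n) →
  Loaded λ' (lab T (branchAddr T hc n)) →
  Σ ℕ λ m → isV T (branchAddr T hc m) × All (lab T (branchAddr T hc m)) (outHC hc λ')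

seqF : List Fact → (Rule → ℕ) → (ℕ → Trigger) → ℕ → FactSet
seqF D hc Λ zero    = asSet D
seqF D hc Λ (suc i) = seqF D hc Λ i ∪L outHC hc (Λ i)

OccursIn : Term → FactSet → Set
OccursIn t F = Σ Fact λ f → F f × (t ∈ Fact.args f)

-- Λ i is the paper's λ_{i+1}
SeqLoaded : List Fact → (Rule → ℕ) → (ℕ → Trigger) → Set
SeqLoaded D hc Λ = ∀ i → Loaded (Λ i) (seqF D hc Λ i)

Growing : List Fact → (Rule → ℕ) → (ℕ → Trigger) → Set
Growing D hc Λ = ∀ i → Σ ℕ λ j → i < j × Σ Term λ t →
  OccursIn t (seqF D hc Λ j) × ¬ OccursIn t (seqF D hc Λ i)

CyclicitySequence : List Rule → List Fact → (Rule → ℕ) → (ℕ → Trigger) → Set₁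
CyclicitySequence R D hc Λ =
  (∀ i → RTrigger R (Λ i)) × SeqLoaded D hc Λ × Growing D hc Λ ×
  (∀ i → GUnblockable R D hc (Λ i))

{-# OPTIONS --safe #-}
module Submission where

-- A finite chase tree has a finite branch for hc, so all labels along that branch lie in the
-- label of its last vertex, a finite fact set. By g-unblockability every fact set F_i of the
-- cyclicity sequence is contained in some label on the branch, hence in that finite set. But a
-- growing sequence of fact sets keeps producing pairwise distinct terms, and a finite set of
-- facts mentions only finitely many terms.

open import Defs
open import Data.List using (List; []; _∷_; _++_; length; lookup; map; concatMap)
open import Data.List.Extrema.Nat using (max; xs≤max)
open import Data.List.Membership.Propositional using (_∈_)
open import Data.List.Membership.Propositional.Properties
  using (∈-++⁺ˡ; ∈-++⁺ʳ; ∈-map⁺; ∈-concatMap⁺)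
open import Data.List.Relation.Unary.All as All using (All)
open import Data.List.Relation.Unary.Any as Any using (index)
open import Data.List.Relation.Unary.Any.Properties using (lookup-index)
open import Data.Fin using (toℕ)
open import Data.Fin.Properties using (pigeonhole)
open import Data.Nat using (ℕ; zero; suc; _≤_; _<_; _≤′_; ≤′-refl; ≤′-step)
open import Data.Nat.Properties using (≤-refl; ≤-trans; ≤-total; ≤⇒≤′; n<1+n; <⇒≤)
open import Data.Product using (Σ; _×_; _,_; proj₁; proj₂)
open import Data.Sum using (inj₁; inj₂; [_,_])
open import Function using (_∘_)
open import Relation.Nullary using (¬_)
open import Relation.Binary.PropositionalEquality using (_≡_; _≢_; refl; sym; trans; cong; subst)

infix 4 _⊆F_

_⊆F_ : FactSet → FactSet → Set
F ⊆F G = ∀ {f} → F f → G f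

∪L-⊆ : ∀ {F G L} → F ⊆F G → All G L → F ∪L L ⊆F G
∪L-⊆ F⊆G L⊆G = [ F⊆G , All.lookup L⊆G ]

Loaded-mono : ∀ λ' {F G} → F ⊆F G → Loaded λ' F → Loaded λ' G
Loaded-mono (trig ρ σ) F⊆G = All.map (λ a∈F → F⊆G a∈F)

OccursIn-mono : ∀ {t F G} → F ⊆F G → OccursIn t F → OccursIn t G
OccursIn-mono F⊆G (f , f∈F , t∈f) = f , F⊆G f∈F , t∈f

Ascending : (ℕ → FactSet) → Set
Ascending F = ∀ m → F m ⊆F F (suc m)

ascending-mono : ∀ {F} → Ascending F → ∀ {m n} → m ≤ n → F m ⊆F F n
ascending-mono {F} asc = go ∘ ≤⇒≤′
  where
  go : ∀ {m n} → m ≤′ n → F m ⊆F F n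
  go ≤′-refl       = λ f∈F → f∈F
  go (≤′-step m≤n) = asc _ ∘ go m≤n

GrowingChain : (ℕ → FactSet) → Set
GrowingChain F = ∀ i → Σ ℕ λ j → i < j × Σ Term λ t → OccursIn t (F j) × ¬ OccursIn t (F i)

growing⇒distinct-terms : ∀ {F} → Ascending F → GrowingChain F →
  Σ (ℕ → Term) λ t → (∀ k → Σ ℕ λ i → OccursIn (t k) (F i)) × (∀ {k l} → k < l → t k ≢ t l)
growing⇒distinct-terms {F} asc grow = term , (λ k → stage (suc k) , new k) , distinct
  where
  stage : ℕ → ℕ
  stage zero    = 0
  stage (suc k) = proj₁ (grow (stage k))

  term : ℕ → Term
  term k = proj₁ (proj₂ (proj₂ (grow (stage k))))

  new : ∀ k → OccursIn (term k) (F (stage (suc k)))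
  new k = proj₁ (proj₂ (proj₂ (proj₂ (grow (stage k)))))

  fresh : ∀ k → ¬ OccursIn (term k) (F (stage k))
  fresh k = proj₂ (proj₂ (proj₂ (proj₂ (grow (stage k)))))

  stage-< : ∀ k → stage k < stage (suc k)
  stage-< k = proj₁ (proj₂ (grow (stage k)))

  stage-mono : ∀ {k l} → k ≤′ l → stage k ≤ stage l
  stage-mono ≤′-refl                   = ≤-refl
  stage-mono {l = suc l} (≤′-step k≤l) = ≤-trans (stage-mono k≤l) (<⇒≤ (stage-< l))

  distinct : ∀ {k l} → k < l → term k ≢ term l
  distinct {k} {l} k<l eq = fresh l (subst (λ t → OccursIn t (F (stage l))) eq
    (OccursIn-mono (ascending-mono asc (stage-mono (≤⇒≤′ k<l))) (new k)))

no-injection-ℕ-into-list : ∀ {a} {A : Set a} (xs : List A) (f : ℕ → A) →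
  (∀ k → f k ∈ xs) → ¬ (∀ {k l} → k < l → f k ≢ f l)
no-injection-ℕ-into-list xs f f∈xs injective
  with i , j , i<j , same ← pigeonhole (n<1+n (length xs)) (λ i → index (f∈xs (toℕ i)))
  = injective i<j (trans (lookup-index (f∈xs (toℕ i)))
                    (trans (cong (lookup xs) same) (sym (lookup-index (f∈xs (toℕ j))))))

terms : List Fact → List Term
terms = concatMap Fact.args

OccursIn⇒∈terms : ∀ {t L} → OccursIn t (asSet L) → t ∈ terms L
OccursIn⇒∈terms (f , f∈L , t∈f) = ∈-concatMap⁺ Fact.args (Any.map (λ { refl → t∈f }) f∈L)

growing⇒¬bounded : ∀ {F} → Ascending F → GrowingChain F →
  ∀ L → ¬ (∀ i → F i ⊆F asSet L)
growing⇒¬bounded asc grow L bounded with t , occurs , distinct ← growing⇒distinct-terms asc grow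
  = no-injection-ℕ-into-list (terms L) t in-L distinct
  where
  in-L : ∀ k → t k ∈ terms L
  in-L k with i , t∈Fi ← occurs k = OccursIn⇒∈terms (OccursIn-mono (bounded i) t∈Fi)

seqF-ascending : ∀ D hc Λ → Ascending (seqF D hc Λ)
seqF-ascending D hc Λ m = inj₁

labelList : List Fact → (Addr → Trigger) → Addr → List Fact
labelList D e []      = D
labelList D e (i ∷ p) = labelList D e p ++ out (e p) i

label⊆labelList : ∀ D e p → label (asSet D) e p ⊆F asSet (labelList D e p)
label⊆labelList D e []      f∈D       = f∈D
label⊆labelList D e (i ∷ p) (inj₁ f∈) = ∈-++⁺ˡ (label⊆labelList D e p f∈)
label⊆labelList D e (i ∷ p) (inj₂ f∈) = ∈-++⁺ʳ (labelList D e p) f∈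

module _ {R D} (T : ChaseTree R D) (hc : Rule → ℕ) where

  branchLabel : ℕ → FactSet
  branchLabel m = lab T (branchAddr T hc m)

  branchLabel-mono : ∀ {m n} → m ≤ n → branchLabel m ⊆F branchLabel n
  branchLabel-mono = ascending-mono (λ m → inj₁)

  length-branchAddr : ∀ m → length (branchAddr T hc m) ≡ m
  length-branchAddr zero    = refl
  length-branchAddr (suc m) = cong suc (length-branchAddr m)

  finite⇒branch-bounded : FiniteTree T →
    Σ ℕ λ N → ∀ m → isV T (branchAddr T hc m) → m ≤ N
  finite⇒branch-bounded (Ls , finite) = max 0 lengths , bounded
    where
    lengths = map length Ls

    bounded : ∀ m → isV T (branchAddr T hc m) → m ≤ max 0 lengths
    bounded m v = subst (_≤ max 0 lengths) (length-branchAddr m)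
      (All.lookup (xs≤max 0 lengths) (∈-map⁺ length (finite _ v)))

  seqF⊆branchLabel : ∀ {Λ} → SeqLoaded D hc Λ → (∀ i → GUnblockable R D hc (Λ i)) →
    ∀ i → Σ ℕ λ m → isV T (branchAddr T hc m) × seqF D hc Λ i ⊆F branchLabel m
  seqF⊆branchLabel loaded unblockable zero = 0 , rootV T , λ f∈D → f∈D
  seqF⊆branchLabel {Λ} loaded unblockable (suc i)
    with m , v , Fi⊆ ← seqF⊆branchLabel loaded unblockable i
    with m' , v' , out⊆ ← unblockable i T m v (Loaded-mono (Λ i) {G = branchLabel m} Fi⊆ (loaded i))
    with ≤-total m m'
  ... | inj₁ m≤m' = m' , v' , ∪L-⊆ (branchLabel-mono m≤m' ∘ Fi⊆) out⊆
  ... | inj₂ m'≤m = m , v , ∪L-⊆ Fi⊆ (All.map (branchLabel-mono m'≤m) out⊆)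

theorem1 : (R : List Rule) → (∀ ρ → ρ ∈ R → WellFormed ρ) →
    Σ (List Fact) (λ D → Database D × Σ (Rule → ℕ) (λ hc → HeadChoice R hc ×
    Σ (ℕ → Trigger) (λ Λ → CyclicitySequence R D hc Λ))) →
    NeverTerminates R
theorem1 R _ (D , db , hc , _ , Λ , _ , loaded , growing , unblockable) = D , db , no-finite-tree
  where
  no-finite-tree : ¬ Σ (ChaseTree R D) FiniteTree
  no-finite-tree (T , finite) with N , bound ← finite⇒branch-bounded T hc finite =
    growing⇒¬bounded (seqF-ascending D hc Λ) growing
      (labelList D (exp T) (branchAddr T hc N)) seqF⊆final
    where
    seqF⊆final : ∀ i → seqF D hc Λ i ⊆F asSet (labelList D (exp T) (branchAddr T hc N))
    seqF⊆final i with m , v , Fi⊆ ← seqF⊆branchLabel T hc loaded unblockable i =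
      label⊆labelList D (exp T) (branchAddr T hc N)
      ∘ branchLabel-mono T hc (bound m v) ∘ Fi⊆
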